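{- Let $G$ be a connected graph with $n$ vertices and price function $P$, and label the vertices so that their prices satisfy $p^{1}\le p^{2}\le\cdots\le p^{n}$. Then for every integer $t$ with $1\le t<n$, \[ \sum_{i=t+1}^{n}(p^{i}-1)+p^{n}(t-1)+1\le \pi_{P}^{t}(G). \]
   Context: A configuration of $k$ pebbles on a graph $G$ is a function $C:V(G)\to\mathbb{Z}_{\ge 0}$ with $\sum_{v}C(v)=k$. A price function is a function $P:V(G)\to\mathbb{Z}_{\ge 2}$. A pebbling move along an edge $v_hv_k$ removes $P(v_h)$ pebbles from $v_h$ and adds one pebble to $v_k$; it is allowed only if the result has no negative values. A configuration $C'$ is derivable from $C$ if it is obtained from $C$ by a finite sequence of pebbling moves. A configuration covers a set of vertices if it is nonzero at each of them. A configuration $C$ is $t$-solvable if for every set of $t$ vertices there is a configuration derivable from $C$ covering that set. For $1\le t\le n$, $\pi_P^t(G)$ is the minimum $k$ such that every configuration of $k$ pebbles on $G$ (with price function $P$) is $t$-solvable. -}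

module Defs where

open import Data.Nat using (ℕ; zero; suc; _+_; _*_; _∸_; _≤_; _<_)
open import Data.Bool using (Bool; true; false; if_then_else_)
open import Data.Fin using (Fin; toℕ; fromℕ; _≟_)
import Data.Fin as F
open import Data.Vec using (Vec; tabulate; sum)
open import Data.Fin.Subset using (Subset; _∈_; ∣_∣)
open import Data.Product using (Σ; ∃; _×_; _,_)
open import Relation.Nullary using (¬_)
open import Relation.Nullary.Decidable using (⌊_⌋)
open import Relation.Binary.PropositionalEquality using (_≡_)
open import Relation.Binary.Construct.Closure.ReflexiveTransitive using (Star)
open import Level using (0ℓ)

record Graph (n : ℕ) : Set₁ where
  field
    Adj     : Fin n → Fin n → Set
    symAdj  : ∀ {u v} → Adj u v → Adj v u
    irrAdj  : ∀ {u} → ¬ Adj u u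
open Graph public

Connected : ∀ {n} → Graph n → Set
Connected {n} G = ∀ (u v : Fin n) → Star (Adj G) u v

PriceFunction : ℕ → Set
PriceFunction n = Fin n → ℕ

IsPrice : ∀ {n} → PriceFunction n → Set
IsPrice {n} P = ∀ (v : Fin n) → 2 ≤ P v

Configuration : ℕ → Set
Configuration n = Fin n → ℕ

size : ∀ {n} → Configuration n → ℕ
size C = sum (tabulate C)

δ : ∀ {n} → Fin n → Fin n → ℕ
δ u w = if ⌊ u ≟ w ⌋ then 1 else 0

data Move {n} (G : Graph n) (P : PriceFunction n)
          (C C' : Configuration n) : Set where
  move : (u v : Fin n) → Adj G u v → P u ≤ C u →
         (∀ w → C' w ≡ (C w ∸ P u * δ u w) + δ v w) →
         Move G P C C'

Derivable : ∀ {n} → Graph n → PriceFunction n →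
            Configuration n → Configuration n → Set
Derivable G P = Star (Move G P)

Covers : ∀ {n} → Configuration n → Subset n → Set
Covers {n} C S = ∀ (v : Fin n) → v ∈ S → 0 < C v

Solvable : ∀ {n} → Graph n → PriceFunction n → ℕ → Configuration n → Set
Solvable {n} G P t C =
  ∀ (S : Subset n) → ∣ S ∣ ≡ t →
    Σ (Configuration n) λ C' → Derivable G P C C' × Covers C' S

AllSolvable : ∀ {n} → Graph n → PriceFunction n → ℕ → ℕ → Set
AllSolvable {n} G P t k =
  ∀ (C : Configuration n) → size C ≡ k → Solvable G P t C

IsPebblingNumber : ∀ {n} → Graph n → PriceFunction n → ℕ → ℕ → Set
IsPebblingNumber G P t k =
  AllSolvable G P t k × (∀ k' → k' < k → ¬ AllSolvable G P t k')

-- Σ_{i : Fin n} f i restricted to indices with toℕ i ≥ t (0-indexed),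
-- i.e. 1-indexed i = t+1 .. n
sumFrom : ∀ {n} → ℕ → (Fin n → ℕ) → ℕ
sumFrom t f = sum (tabulate λ i → if ⌊ t Data.Nat.≤? toℕ i ⌋ then f i else 0)

-- Give each vertex w the weight ⌊(C w + e w) / P w⌋, where the offset e w is P w − 1 on a
-- set S of t target vertices and 0 elsewhere, and let Φ C be the total weight.  A pebbling
-- move from u takes P u pebbles off u, lowering the weight of u by exactly one, and adds a
-- single pebble somewhere, raising one weight by at most one; so Φ never increases.  A
-- configuration covering S has Φ ≥ t.  Placing P w − 1 pebbles on every vertex outside S
-- and (t − 1)·P u further pebbles on one vertex u gives Φ = t − 1, so neither this
-- configuration nor any configuration it contains is t-solvable.
module Submission where

open import Defs
open import Data.Nat using (ℕ; suc; _+_; _*_; _∸_; _≤_; _<_)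
open import Data.Fin using (Fin; fromℕ)

open import Data.Bool.Base using (Bool; true; false; not; if_then_else_)
open import Data.Bool.Properties using (if-not; if-cong)
open import Data.Fin.Base using (zero; suc; toℕ; punchIn)
open import Data.Fin.Properties using (punchInᵢ≢i)
open import Data.Fin.Subset using (Subset; ∣_∣)
open import Data.Nat.Base using (zero; z≤n; s≤s; pred; NonZero; >-nonZero; >-nonZero⁻¹)
open import Data.Nat.DivMod
open import Data.Nat.Divisibility using (n∣m*n)
open import Data.Nat.Properties
open import Algebra.Properties.CommutativeSemigroup +-commutativeSemigroup
  using (xy∙z≈xz∙y)
open import Algebra.Properties.Semiring.Sum +-*-semiring
  using (sum-syntax; ∑-distrib-+; sum-cong-≗; sum-replicate-zero; sum-remove)
open import Data.Product using (Σ; _×_; _,_)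
open import Data.Vec.Base as Vec using ([]; _∷_)
open import Data.Vec.Properties using (lookup∘tabulate; tabulate-cong; lookup⇒[]=)
open import Function.Base using (_∘_)
open import Relation.Binary.Construct.Closure.ReflexiveTransitive using (ε; _◅_)
open import Relation.Binary.PropositionalEquality
open import Relation.Nullary using (yes; no; contradiction)
open import Relation.Nullary.Decidable using (⌊_⌋; isYes≗does)

sum-tabulate : ∀ {n} (f : Fin n → ℕ) → Vec.sum (Vec.tabulate f) ≡ ∑[ i < n ] f i
sum-tabulate {zero}  f = refl
sum-tabulate {suc n} f = cong (f zero +_) (sum-tabulate (f ∘ suc))

∑-mono-≤ : ∀ {n} {f g : Fin n → ℕ} → (∀ i → f i ≤ g i) → ∑[ i < n ] f i ≤ ∑[ i < n ] g i
∑-mono-≤ {zero}  f≤g = z≤n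
∑-mono-≤ {suc n} f≤g = +-mono-≤ (f≤g zero) (∑-mono-≤ (f≤g ∘ suc))

δ-diag : ∀ {n} (u : Fin n) → δ u u ≡ 1
δ-diag u with u Data.Fin.≟ u
... | yes _   = refl
... | no u≢u = contradiction refl u≢u

δ-off : ∀ {n} {u w : Fin n} → u ≢ w → δ u w ≡ 0
δ-off {u = u} {w} u≢w with u Data.Fin.≟ w
... | yes u≡w = contradiction u≡w u≢w
... | no _    = refl

∑-δ : ∀ {n} (u : Fin n) (f : Fin n → ℕ) → ∑[ w < n ] (δ u w * f w) ≡ f u
∑-δ {suc n} u f = begin
  ∑[ w < suc n ] (δ u w * f w)
    ≡⟨ sum-remove {i = u} (λ w → δ u w * f w) ⟩
  δ u u * f u + ∑[ w < n ] (δ u (punchIn u w) * f (punchIn u w))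
    ≡⟨ cong₂ _+_ u-term (sum-cong-≗ other-terms) ⟩
  1 * f u + ∑[ w < n ] 0
    ≡⟨ cong₂ _+_ (*-identityˡ (f u)) (sum-replicate-zero n) ⟩
  f u + 0
    ≡⟨ +-identityʳ (f u) ⟩
  f u ∎
  where
  open ≡-Reasoning
  u-term : δ u u * f u ≡ 1 * f u
  u-term = cong (_* f u) (δ-diag u)
  other-terms : ∀ w → δ u (punchIn u w) * f (punchIn u w) ≡ 0
  other-terms w = cong (_* f (punchIn u w)) (δ-off (punchInᵢ≢i u w ∘ sym))

∑-+δ : ∀ {n} (f : Fin n → ℕ) (u : Fin n) → ∑[ w < n ] (f w + δ u w) ≡ ∑[ w < n ] f w + 1
∑-+δ {n} f u = begin
  ∑[ w < n ] (f w + δ u w)            ≡⟨ ∑-distrib-+ f (δ u) ⟩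
  ∑[ w < n ] f w + ∑[ w < n ] δ u w   ≡⟨ cong (∑[ w < n ] f w +_) ∑δ≡1 ⟩
  ∑[ w < n ] f w + 1                  ∎
  where
  open ≡-Reasoning
  ∑δ≡1 : ∑[ w < n ] δ u w ≡ 1
  ∑δ≡1 = trans (sum-cong-≗ (λ w → sym (*-identityʳ (δ u w)))) (∑-δ u (λ _ → 1))

inside outside : ∀ {n} → Subset n → (Fin n → ℕ) → Fin n → ℕ
inside  S f w = if Vec.lookup S w then f w else 0
outside S f w = if Vec.lookup S w then 0 else f w

outside+inside : ∀ {n} (S : Subset n) (f : Fin n → ℕ) w → outside S f w + inside S f w ≡ f w
outside+inside S f w with Vec.lookup S w
... | true  = refl
... | false = +-identityʳ (f w)

∣p∣≡∑inside : ∀ {n} (p : Subset n) → ∣ p ∣ ≡ ∑[ i < n ] inside p (λ _ → 1) i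
∣p∣≡∑inside []          = refl
∣p∣≡∑inside (true ∷ p)  = cong suc (∣p∣≡∑inside p)
∣p∣≡∑inside (false ∷ p) = ∣p∣≡∑inside p

pred[n]<n : ∀ {n} → 0 < n → pred n < n
pred[n]<n {suc n} _ = n<1+n n

pred[n]/n≡0 : ∀ n .{{_ : NonZero n}} → pred n / n ≡ 0
pred[n]/n≡0 n = m<n⇒m/n≡0 (pred[n]<n (>-nonZero⁻¹ n))

[m+pred[n]]/n>0 : ∀ m n .{{_ : NonZero n}} → 0 < m → 0 < (m + pred n) / n
[m+pred[n]]/n>0 m n 0<m = m≥n⇒m/n>0 (begin
  n             ≡⟨ suc-pred n ⟨
  1 + pred n    ≤⟨ +-monoˡ-≤ (pred n) 0<m ⟩
  m + pred n    ∎)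
  where open ≤-Reasoning

[m+kn]/n≡m/n+k : ∀ m k n .{{_ : NonZero n}} → (m + k * n) / n ≡ m / n + k
[m+kn]/n≡m/n+k m k n = trans (+-distrib-/-∣ʳ m (n∣m*n k)) (cong (m / n +_) (m*n/n≡m k n))

[m+n]/o≤m/o+n : ∀ m n o .{{_ : NonZero o}} → (m + n) / o ≤ m / o + n
[m+n]/o≤m/o+n m n o = begin
  (m + n) / o      ≤⟨ /-monoˡ-≤ o (+-monoʳ-≤ m (m≤m*n n o)) ⟩
  (m + n * o) / o  ≡⟨ [m+kn]/n≡m/n+k m n o ⟩
  m / o + n        ∎
  where open ≤-Reasoning

[m+o]/n≡[m∸n+o]/n+1 : ∀ m o n .{{_ : NonZero n}} → n ≤ m → (m + o) / n ≡ (m ∸ n + o) / n + 1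
[m+o]/n≡[m∸n+o]/n+1 m o n n≤m = begin
  (m + o) / n              ≡⟨ /-congˡ (cong (_+ o) (m∸n+n≡m n≤m)) ⟨
  (m ∸ n + n + o) / n      ≡⟨ /-congˡ (xy∙z≈xz∙y (m ∸ n) n o) ⟩
  (m ∸ n + o + n) / n      ≡⟨ /-congˡ (cong (m ∸ n + o +_) (*-identityˡ n)) ⟨
  (m ∸ n + o + 1 * n) / n  ≡⟨ [m+kn]/n≡m/n+k (m ∸ n + o) 1 n ⟩
  (m ∸ n + o) / n + 1      ∎
  where open ≡-Reasoning

subconfiguration : ∀ {n} (C : Configuration n) {j} → j ≤ size C →
                   Σ (Configuration n) λ D → (∀ w → D w ≤ C w) × size D ≡ j
subconfiguration {zero}  C j≤0 = C , (λ ()) , sym (n≤0⇒n≡0 j≤0)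
subconfiguration {suc n} C {j} j≤size with j ≤? size (C ∘ suc)
... | yes j≤rest =
  let (D , D≤C , size-D) = subconfiguration (C ∘ suc) j≤rest
  in  (λ { zero → 0 ; (suc w) → D w }) , (λ { zero → z≤n ; (suc w) → D≤C w }) , size-D
... | no j≰rest =
  (λ { zero → j ∸ rest ; (suc w) → C (suc w) }) ,
  (λ { zero → head≤ ; (suc w) → ≤-refl }) ,
  m∸n+n≡m (≰⇒≥ j≰rest)
  where
  rest = size (C ∘ suc)
  head≤ : j ∸ rest ≤ C zero
  head≤ = m≤n+o⇒m∸n≤o j rest (subst (j ≤_) (+-comm (C zero) rest) j≤size)

module Potential {n} (P : PriceFunction n) (P≢0 : ∀ w → NonZero (P w)) (e : Fin n → ℕ) where

  instance
    P-nonZero : ∀ {w} → NonZero (P w)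
    P-nonZero = P≢0 _

  weight : Fin n → ℕ → ℕ
  weight w c = (c + e w) / P w

  Φ : Configuration n → ℕ
  Φ C = ∑[ w < n ] weight w (C w)

  Φ-mono-≤ : ∀ {C D : Configuration n} → (∀ w → D w ≤ C w) → Φ D ≤ Φ C
  Φ-mono-≤ D≤C = ∑-mono-≤ λ w → /-monoˡ-≤ (P w) (+-monoˡ-≤ (e w) (D≤C w))

  weight-+ : ∀ w c d → weight w (c + d) ≤ weight w c + d
  weight-+ w c d = begin
    (c + d + e w) / P w  ≡⟨ /-congˡ (xy∙z≈xz∙y c d (e w)) ⟩
    (c + e w + d) / P w  ≤⟨ [m+n]/o≤m/o+n (c + e w) d (P w) ⟩
    weight w c + d       ∎
    where open ≤-Reasoning

  module _ {C : Configuration n} (u : Fin n) (enough : P u ≤ C u) where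

    spend : Configuration n
    spend w = C w ∸ P u * δ u w

    -- Abstracting over u ≟ w also abstracts the test inside δ u w, which then computes.
    weight-spend : ∀ w → weight w (C w) ≡ weight w (spend w) + δ u w
    weight-spend w with u Data.Fin.≟ w
    ... | yes refl rewrite *-identityʳ (P u) = [m+o]/n≡[m∸n+o]/n+1 (C u) (e u) (P u) enough
    ... | no _     rewrite *-zeroʳ (P u)     = sym (+-identityʳ _)

    Φ-spend : Φ C ≡ Φ spend + 1
    Φ-spend = trans (sum-cong-≗ weight-spend) (∑-+δ (λ w → weight w (spend w)) u)

  Φ-move : ∀ {G} {C C' : Configuration n} → Move G P C C' → Φ C' ≤ Φ C
  Φ-move {C = C} {C'} (move u v _ enough C'≡) = begin
    Φ C'                                        ≡⟨ sum-cong-≗ (λ w → cong (weight w) (C'≡ w)) ⟩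
    ∑[ w < n ] weight w (spent w + δ v w)       ≤⟨ ∑-mono-≤ (λ w → weight-+ w (spent w) (δ v w)) ⟩
    ∑[ w < n ] (weight w (spent w) + δ v w)     ≡⟨ ∑-+δ (λ w → weight w (spent w)) v ⟩
    Φ spent + 1                                 ≡⟨ Φ-spend u enough ⟨
    Φ C                                         ∎
    where
    open ≤-Reasoning
    spent = spend u enough

  Φ-derivable : ∀ {G} {C C' : Configuration n} → Derivable G P C C' → Φ C' ≤ Φ C
  Φ-derivable ε              = ≤-refl
  Φ-derivable (step ◅ steps) = ≤-trans (Φ-derivable steps) (Φ-move step)

module TargetPotential {n} (P : PriceFunction n) (P≢0 : ∀ w → NonZero (P w)) (S : Subset n) where

  open Potential P P≢0 (inside S (pred ∘ P)) public

  ∣S∣≤Φ : ∀ {C} → Covers C S → ∣ S ∣ ≤ Φ C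
  ∣S∣≤Φ {C} covered = begin
    ∣ S ∣                               ≡⟨ ∣p∣≡∑inside S ⟩
    ∑[ w < n ] inside S (λ _ → 1) w     ≤⟨ ∑-mono-≤ indicator≤weight ⟩
    Φ C                                 ∎
    where
    open ≤-Reasoning
    indicator≤weight : ∀ w → inside S (λ _ → 1) w ≤ weight w (C w)
    indicator≤weight w with Vec.lookup S w in w∈S
    ... | false = z≤n
    ... | true  = [m+pred[n]]/n>0 (C w) (P w) (covered w (lookup⇒[]= w S w∈S))

  -- AllSolvable only speaks of configurations of exactly k pebbles, hence the sub-configuration.
  AllSolvable⇒Φ<t⇒size< : ∀ {G t k C} → ∣ S ∣ ≡ t → AllSolvable G P t k → Φ C < t → size C < k
  AllSolvable⇒Φ<t⇒size< {t = t} {C = C} ∣S∣≡t solvable Φ<t = ≰⇒> λ k≤size →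
    let (D , D≤C , size-D)      = subconfiguration C k≤size
        (C' , D⇒C' , covered) = solvable D size-D S ∣S∣≡t
    in  <⇒≱ Φ<t (begin
          t      ≡⟨ ∣S∣≡t ⟨
          ∣ S ∣  ≤⟨ ∣S∣≤Φ covered ⟩
          Φ C'   ≤⟨ Φ-derivable D⇒C' ⟩
          Φ D    ≤⟨ Φ-mono-≤ D≤C ⟩
          Φ C    ∎)
    where open ≤-Reasoning

  extremal : Fin n → ℕ → Configuration n
  extremal u k w = outside S (pred ∘ P) w + δ u w * k * P w

  Φ-extremal : ∀ u k → Φ (extremal u k) ≡ k
  Φ-extremal u k = trans (sum-cong-≗ weight-extremal) (∑-δ u (λ _ → k))
    where
    open ≡-Reasoning
    weight-extremal : ∀ w → weight w (extremal u k w) ≡ δ u w * k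
    weight-extremal w = begin
      (out + δ u w * k * P w + ins) / P w  ≡⟨ /-congˡ (xy∙z≈xz∙y out (δ u w * k * P w) ins) ⟩
      (out + ins + δ u w * k * P w) / P w  ≡⟨ /-congˡ (cong (_+ δ u w * k * P w) out+ins) ⟩
      (pred (P w) + δ u w * k * P w) / P w ≡⟨ [m+kn]/n≡m/n+k (pred (P w)) (δ u w * k) (P w) ⟩
      pred (P w) / P w + δ u w * k         ≡⟨ cong (_+ δ u w * k) (pred[n]/n≡0 (P w)) ⟩
      δ u w * k                            ∎
      where
      out = outside S (pred ∘ P) w
      ins = inside S (pred ∘ P) w
      out+ins : out + ins ≡ pred (P w)
      out+ins = outside+inside S (pred ∘ P) w

  size-extremal : ∀ u k → size (extremal u k) ≡ ∑[ w < n ] outside S (pred ∘ P) w + k * P u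
  size-extremal u k = begin
    size (extremal u k)                                  ≡⟨ sum-tabulate (extremal u k) ⟩
    ∑[ w < n ] (out w + δ u w * k * P w)                 ≡⟨ ∑-distrib-+ out (λ w → δ u w * k * P w) ⟩
    ∑[ w < n ] out w + ∑[ w < n ] (δ u w * k * P w)      ≡⟨ cong (∑[ w < n ] out w +_) ∑δkP ⟩
    ∑[ w < n ] out w + k * P u                           ∎
    where
    open ≡-Reasoning
    out = outside S (pred ∘ P)
    ∑δkP : ∑[ w < n ] (δ u w * k * P w) ≡ k * P u
    ∑δkP = trans (sum-cong-≗ (λ w → *-assoc (δ u w) k (P w))) (∑-δ u (λ w → k * P w))

-- The vertices 0, …, t − 1, with membership phrased through the test used by sumFrom.
initialSegment : ∀ n → ℕ → Subset n
initialSegment n t = Vec.tabulate λ w → not ⌊ t ≤? toℕ w ⌋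

∣initialSegment∣ : ∀ {n t} → t ≤ n → ∣ initialSegment n t ∣ ≡ t
∣initialSegment∣ {zero}          z≤n       = refl
∣initialSegment∣ {suc n} {zero}  z≤n       = ∣initialSegment∣ {n} z≤n
∣initialSegment∣ {suc n} {suc t} (s≤s t≤n) =
  cong suc (trans (cong (∣_∣ {n}) (tabulate-cong (λ w → cong not (1+t≤?1+x t (toℕ w)))))
                  (∣initialSegment∣ t≤n))
  where
  1+t≤?1+x : ∀ t x → ⌊ suc t ≤? suc x ⌋ ≡ ⌊ t ≤? x ⌋
  1+t≤?1+x zero    x = refl
  1+t≤?1+x (suc t) x = trans (isYes≗does (2 + t ≤? suc x)) (sym (isYes≗does (suc t ≤? x)))

sumFrom≡∑outside : ∀ {n} t (f : Fin n → ℕ) → sumFrom t f ≡ ∑[ w < n ] outside (initialSegment n t) f w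
sumFrom≡∑outside {n} t f =
  trans (sum-tabulate (λ w → if beyond w then f w else 0)) (sum-cong-≗ {n} λ w →
    sym (trans (if-cong (lookup∘tabulate (not ∘ beyond) w)) (if-not (beyond w))))
  where
  beyond : Fin n → Bool
  beyond w = ⌊ t ≤? toℕ w ⌋

theorem8 : (m : ℕ) (G : Graph (suc m)) (P : PriceFunction (suc m)) →
    Connected G → IsPrice P →
    (∀ (i j : Fin (suc m)) → i Data.Fin.≤ j → P i Data.Nat.≤ P j) →
    (t : ℕ) → 1 Data.Nat.≤ t → t < suc m →
    (k : ℕ) → IsPebblingNumber G P t k →
    sumFrom t (λ i → P i ∸ 1) + P (fromℕ m) * (t ∸ 1) + 1 Data.Nat.≤ k
theorem8 m _ P _ isPrice _ t 1≤t t<1+m k (allSolvable , _) = begin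
  sumFrom t (pred ∘ P) + P top * (t ∸ 1) + 1
    ≡⟨ cong₂ (λ a b → a + b + 1) (sumFrom≡∑outside t (pred ∘ P)) (*-comm (P top) (t ∸ 1)) ⟩
  ∑[ w < suc m ] outside S (pred ∘ P) w + (t ∸ 1) * P top + 1
    ≡⟨ cong (_+ 1) (size-extremal top (t ∸ 1)) ⟨
  size C + 1
    ≡⟨ +-comm (size C) 1 ⟩
  suc (size C)
    ≤⟨ AllSolvable⇒Φ<t⇒size< {C = C} (∣initialSegment∣ (<⇒≤ t<1+m)) allSolvable Φ<t ⟩
  k ∎
  where
  open ≤-Reasoning
  P≢0 : ∀ w → NonZero (P w)
  P≢0 w = >-nonZero (≤-trans (s≤s z≤n) (isPrice w))
  top = fromℕ m
  S = initialSegment (suc m) t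
  open TargetPotential P P≢0 S
  C = extremal top (t ∸ 1)
  Φ<t : Φ C < t
  Φ<t = subst (_< t) (sym (Φ-extremal top (t ∸ 1))) (pred[n]<n 1≤t)
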